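{- Let $n \geq 2$ be an integer. The eigenvalues (with multiplicity) of the adjacency matrix of the graph $(\overline{S_{n,n}})^+$ are \[ n-1+\sqrt{n^2-3n+3},\quad -1+\sqrt{n-1},\quad -1-\sqrt{n-1},\quad n-1-\sqrt{n^2-3n+3}, \] together with $-1$ of multiplicity $2n-4$.
   Context: For positive integers $n_1, n_2$, the double star $S_{n_1,n_2}$ is the graph obtained by taking disjoint stars $K_{1,n_1-1}$ (with center $v_1$) and $K_{1,n_2-1}$ (with center $v_2$) and adding the edge $v_1v_2$. $\overline{S_{n_1,n_2}}$ denotes its complement (in which $v_1$ and $v_2$ are non-adjacent), and $(\overline{S_{n_1,n_2}})^+$ denotes the graph obtained from $\overline{S_{n_1,n_2}}$ by adding the edge $v_1v_2$. Thus $(\overline{S_{n,n}})^+$ consists of two cliques $K_{n-1}$ (the leaves of each star) joined completely to each other, with $v_1$ adjacent exactly to all vertices of the clique formed by the leaves of the second star and to $v_2$, and $v_2$ adjacent exactly to all vertices of the clique formed by the leaves of the first star and to $v_1$. -}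

module Defs where

open import Level using (Level)
open import Data.Nat as ℕ using (ℕ; zero; suc; _<?_) renaming (_≟_ to _≟ℕ_)
open import Data.Fin as F using (Fin; _≟_; punchIn; toℕ)
open import Data.Bool using (Bool; true; false; _∧_; _∨_; not; if_then_else_)
open import Data.List using (List; []; _∷_)
open import Relation.Nullary.Decidable using (⌊_⌋)
open import Algebra.Bundles using (CommutativeRing)

Graph : ℕ → Set
Graph N = Fin N → Fin N → Bool

-- Vertex layout for S_{n1,n2} on Fin (n1 ℕ.+ n2):
--   indices 0 .. n1-1 belong to the first star, with centre v1 = index 0;
--   indices n1 .. n1+n2-1 belong to the second star, with centre v2 = index n1.
first? : ∀ n1 {n2} → Fin (n1 ℕ.+ n2) → Bool
first? n1 i = ⌊ toℕ i <? n1 ⌋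

centre? : ∀ n1 {n2} → Fin (n1 ℕ.+ n2) → Bool
centre? n1 i = ⌊ toℕ i ≟ℕ 0 ⌋ ∨ ⌊ toℕ i ≟ℕ n1 ⌋

-- The double star S_{n1,n2}: each centre adjacent to the leaves of its own
-- star, plus the edge v1 v2 between the two centres.
doubleStar : (n1 n2 : ℕ) → Graph (n1 ℕ.+ n2)
doubleStar n1 n2 i j =
  not ⌊ i ≟ j ⌋ ∧
  ( (sameStar ∧ (centre? n1 i ∨ centre? n1 j))
  ∨ (not sameStar ∧ centre? n1 i ∧ centre? n1 j) )
  where
  sameStar : Bool
  sameStar = if first? n1 i then first? n1 j else not (first? n1 j)

complement : ∀ {N} → Graph N → Graph N
complement G i j = not ⌊ i ≟ j ⌋ ∧ not (G i j)

SbarPlus : (n1 n2 : ℕ) → Graph (n1 ℕ.+ n2)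
SbarPlus n1 n2 i j =
  complement (doubleStar n1 n2) i j
  ∨ (centre? n1 i ∧ centre? n1 j ∧ not ⌊ i ≟ j ⌋)

module RingDefs {c ℓ : Level} (R : CommutativeRing c ℓ) where
  open CommutativeRing R

  Matrix : ℕ → Set c
  Matrix N = Fin N → Fin N → Carrier

  nat : ℕ → Carrier
  nat zero = 0#
  nat (suc k) = 1# + nat k

  pow : Carrier → ℕ → Carrier
  pow x zero = 1#
  pow x (suc k) = x * pow x k

  prod : List Carrier → Carrier
  prod [] = 1#
  prod (x ∷ xs) = x * prod xs

  minor : ∀ {N} → Matrix (suc N) → Fin (suc N) → Matrix N
  minor M j r k = M (F.suc r) (punchIn j k)

  det : ∀ {N} → Matrix N → Carrier
  -- alternating sum  Σ_{j ≥ k} (-1)^(j-k) M 0 j det(minor M j), over columns j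
  cofSum : ∀ {N} → Matrix (suc N) → (K : ℕ) → (Fin K → Fin (suc N)) → Carrier
  det {zero} M = 1#
  det {suc N} M = cofSum M (suc N) (λ j → j)
  cofSum M zero f = 0#
  cofSum M (suc K) f = M F.zero (f F.zero) * det (minor M (f F.zero)) - cofSum M K (λ j → f (F.suc j))

  adjacency : ∀ {N} → Graph N → Matrix N
  adjacency G i j = if G i j then 1# else 0#

  identity : ∀ {N} → Matrix N
  identity i j = if ⌊ i ≟ j ⌋ then 1# else 0#

  charPoly : ∀ {N} → Matrix N → Carrier → Carrier
  charPoly A x = det (λ i j → x * identity i j - A i j)

-- Order the vertices v₁, the leaves of the first star, v₂, the leaves of the second star. In xI − A
-- an off-diagonal entry depends only on the kinds (centre or leaf, which star) of its row and column.
-- The determinant is affine in each diagonal entry: lowering a leaf's diagonal entry from x to −1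
-- changes it by (x + 1) times the determinant with that leaf deleted. Two leaves of one star whose
-- diagonal entries are both −1 give equal columns, since −1 is also the entry between them. Peeling
-- off the leaves of each star one at a time thus gives F(a + 1) = (x + 1)^a (F(1) + a G(0)), where G
-- has an extra leaf with diagonal −1, and reduces the characteristic polynomial to four 4 × 4
-- determinants; a polynomial identity then yields
--   (x + 1)^(2n − 4) ((x − n + 1)² − (n² − 3n + 3)) ((x + 1)² − (n − 1)).

module Submission where

open import Defs
open import Level using (Level; _⊔_)
open import Algebra.Bundles using (CommutativeRing)
import Algebra.Solver.Ring.AlmostCommutativeRing as ACR
open import Data.Nat as ℕ using (ℕ; zero; suc; z≤n; s≤s; _≤_; _∸_; _<ᵇ_; _≡ᵇ_) renaming (_*_ to _*ℕ_)
import Data.Nat.Properties as ℕ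
open import Data.Integer as ℤ using (ℤ; +_; -[1+_]; _⊖_; ∣_∣; _◃_)
import Data.Integer.Properties as ℤ
open import Data.Sign as Sign using (Sign)
open import Data.Fin using (Fin; zero; suc; punchIn; inject₁; toℕ; _≟_)
open import Data.Fin.Properties using (punchInᵢ≢i; punchIn-injective; suc-injective)
open import Data.Vec using (Vec; []; _∷_; _++_; lookup; replicate; insertAt)
open import Data.Vec.Properties using (lookup-replicate; insertAt-lookup; insertAt-punchIn)
open import Data.List using ([]; _∷_)
open import Data.Bool using (Bool; true; false; not; _∧_; _∨_; if_then_else_)
open import Data.Bool.Properties using (∧-zeroʳ; ∧-identityʳ)
open import Data.Product using (∃; _×_; _,_; proj₁; proj₂)
open import Data.Sum using (_⊎_; inj₁; inj₂)
open import Data.Maybe using (Maybe; just; nothing)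
open import Data.Empty using (⊥)
open import Data.Unit using (⊤; tt)
open import Function using (_∘_)
open import Relation.Binary.PropositionalEquality as ≡ using (_≡_; _≢_)
open import Relation.Nullary using (contradiction)
open import Relation.Nullary.Decidable using (⌊_⌋; yes; no; isYes≗does; dec-true; dec-false)

punchIn-cases : ∀ {n} (c k : Fin (suc n)) → k ≡ c ⊎ ∃ λ k′ → punchIn c k′ ≡ k
punchIn-cases zero zero = inj₁ ≡.refl
punchIn-cases zero (suc k) = inj₂ (k , ≡.refl)
punchIn-cases {suc n} (suc c) zero = inj₂ (zero , ≡.refl)
punchIn-cases {suc n} (suc c) (suc k) with punchIn-cases c k
... | inj₁ k≡c = inj₁ (≡.cong suc k≡c)
... | inj₂ (k′ , eq) = inj₂ (suc k′ , ≡.cong suc eq)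

-- The index that column c gets in the minor obtained by deleting column punchIn c k.
pivotAfter : ∀ {n} → Fin (suc n) → Fin n → Fin n
pivotAfter zero zero = zero
pivotAfter zero (suc _) = zero
pivotAfter (suc c) zero = c
pivotAfter (suc c) (suc k) = suc (pivotAfter c k)

punchIn-pivotAfter : ∀ {n} (c : Fin (suc n)) (k : Fin n) → punchIn (punchIn c k) (pivotAfter c k) ≡ c
punchIn-pivotAfter zero zero = ≡.refl
punchIn-pivotAfter zero (suc k) = ≡.refl
punchIn-pivotAfter (suc c) zero = ≡.refl
punchIn-pivotAfter (suc c) (suc k) = ≡.cong suc (punchIn-pivotAfter c k)

punchIn-punchIn-pivotAfter : ∀ {n} (c : Fin (suc (suc n))) (k : Fin (suc n)) (l : Fin n) →
  punchIn (punchIn c k) (punchIn (pivotAfter c k) l) ≡ punchIn c (punchIn k l)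
punchIn-punchIn-pivotAfter zero zero l = ≡.refl
punchIn-punchIn-pivotAfter zero (suc k) l = ≡.refl
punchIn-punchIn-pivotAfter (suc c) zero l = ≡.refl
punchIn-punchIn-pivotAfter (suc c) (suc k) zero = ≡.refl
punchIn-punchIn-pivotAfter (suc c) (suc k) (suc l) = ≡.cong suc (punchIn-punchIn-pivotAfter c k l)

-- Positions of Fin (suc n) other than inject₁ c and suc c.
OffPair : ∀ {n} → Fin n → Fin (suc n) → Set
OffPair zero zero = ⊥
OffPair zero (suc zero) = ⊥
OffPair zero (suc (suc k)) = ⊤
OffPair (suc c) zero = ⊤
OffPair (suc c) (suc k) = OffPair c k

punchIn-pair : ∀ {n} (c l : Fin n) →
  punchIn (inject₁ c) l ≡ punchIn (suc c) l ⊎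
  (punchIn (inject₁ c) l ≡ suc c × punchIn (suc c) l ≡ inject₁ c)
punchIn-pair zero zero = inj₂ (≡.refl , ≡.refl)
punchIn-pair zero (suc l) = inj₁ ≡.refl
punchIn-pair (suc c) zero = inj₁ ≡.refl
punchIn-pair (suc c) (suc l) with punchIn-pair c l
... | inj₁ eq = inj₁ (≡.cong suc eq)
... | inj₂ (eq₁ , eq₂) = inj₂ (≡.cong suc eq₁ , ≡.cong suc eq₂)

punchIn-OffPair : ∀ {n} (c : Fin (suc n)) (k : Fin (suc (suc n))) → OffPair c k →
  ∃ λ c′ → punchIn k (inject₁ c′) ≡ inject₁ c × punchIn k (suc c′) ≡ suc c
punchIn-OffPair zero (suc (suc zero)) _ = zero , ≡.refl , ≡.refl
punchIn-OffPair zero (suc (suc (suc k))) _ = zero , ≡.refl , ≡.refl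
punchIn-OffPair (suc c) zero _ = c , ≡.refl , ≡.refl
punchIn-OffPair {suc n} (suc c) (suc k) off with punchIn-OffPair c k off
... | c′ , eq₁ , eq₂ = suc c′ , ≡.cong suc eq₁ , ≡.cong suc eq₂

⌊≟⌋-refl : ∀ {n} (i : Fin n) → ⌊ i ≟ i ⌋ ≡ true
⌊≟⌋-refl i = ≡.trans (isYes≗does (i ≟ i)) (dec-true (i ≟ i) ≡.refl)

⌊punchIn≟pivot⌋ : ∀ {n} (c : Fin (suc n)) (k : Fin n) → ⌊ punchIn c k ≟ c ⌋ ≡ false
⌊punchIn≟pivot⌋ c k =
  ≡.trans (isYes≗does (punchIn c k ≟ c)) (dec-false (punchIn c k ≟ c) (punchInᵢ≢i c k))

⌊pivot≟punchIn⌋ : ∀ {n} (c : Fin (suc n)) (k : Fin n) → ⌊ c ≟ punchIn c k ⌋ ≡ false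
⌊pivot≟punchIn⌋ c k =
  ≡.trans (isYes≗does (c ≟ punchIn c k)) (dec-false (c ≟ punchIn c k) (punchInᵢ≢i c k ∘ ≡.sym))

⌊punchIn≟punchIn⌋ : ∀ {n} (c : Fin (suc n)) (i j : Fin n) → ⌊ punchIn c i ≟ punchIn c j ⌋ ≡ ⌊ i ≟ j ⌋
⌊punchIn≟punchIn⌋ c i j with i ≟ j
... | yes ≡.refl = ⌊≟⌋-refl (punchIn c i)
... | no i≢j = ≡.trans (isYes≗does (punchIn c i ≟ punchIn c j))
                 (dec-false (punchIn c i ≟ punchIn c j) (i≢j ∘ punchIn-injective c i j))

inject₁≢suc : ∀ {n} (c : Fin n) → inject₁ c ≢ suc c
inject₁≢suc zero ()
inject₁≢suc (suc c) eq = inject₁≢suc c (suc-injective eq)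

module IntegerCoefficientSolver {c ℓ : Level} (R : CommutativeRing c ℓ) where
  open CommutativeRing R
  open import Algebra.Properties.Ring ring using (-‿involutive; -1*x≈-x; -0#≈0#; -‿+-comm)
  open import Algebra.Properties.Semiring.Mult.TCOptimised semiring using (1+×; ×-homo-+; ×1-homo-*) renaming (_×_ to _×′_)
  open import Relation.Binary.Reasoning.Setoid setoid

  -- With the optimised multiple, ⟦ + 1 ⟧ is definitionally 1#, so solver terms match goals mentioning 1#.
  private
    ⟦_⟧ : ℤ → Carrier
    ⟦ + n ⟧ = n ×′ 1#
    ⟦ -[1+ n ] ⟧ = - (suc n ×′ 1#)

    one-plus-cancel : ∀ a b → (1# + a) - (1# + b) ≈ a - b
    one-plus-cancel a b = begin
      (1# + a) - (1# + b)        ≈⟨ +-cong (+-comm a 1#) (-‿+-comm 1# b) ⟨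
      (a + 1#) + (- 1# + - b)    ≈⟨ +-assoc a 1# _ ⟩
      a + (1# + (- 1# + - b))    ≈⟨ +-congˡ (+-assoc 1# (- 1#) (- b)) ⟨
      a + ((1# - 1#) + - b)      ≈⟨ +-congˡ (+-congʳ (-‿inverseʳ 1#)) ⟩
      a + (0# + - b)             ≈⟨ +-congˡ (+-identityˡ (- b)) ⟩
      a - b                      ∎

    ⊖-homo : ∀ m n → ⟦ m ⊖ n ⟧ ≈ m ×′ 1# - n ×′ 1#
    ⊖-homo zero zero = sym (-‿inverseʳ 0#)
    ⊖-homo zero (suc n) = sym (+-identityˡ _)
    ⊖-homo (suc m) zero = sym (trans (+-congˡ -0#≈0#) (+-identityʳ _))
    ⊖-homo (suc m) (suc n) = begin
      ⟦ suc m ⊖ suc n ⟧                ≡⟨ ≡.cong ⟦_⟧ (ℤ.[1+m]⊖[1+n]≡m⊖n m n) ⟩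
      ⟦ m ⊖ n ⟧                        ≈⟨ ⊖-homo m n ⟩
      m ×′ 1# - n ×′ 1#                ≈⟨ one-plus-cancel (m ×′ 1#) (n ×′ 1#) ⟨
      (1# + m ×′ 1#) - (1# + n ×′ 1#)  ≈⟨ +-cong (1+× m 1#) (-‿cong (1+× n 1#)) ⟨
      suc m ×′ 1# - suc n ×′ 1#        ∎

    +-homo : ∀ i j → ⟦ i ℤ.+ j ⟧ ≈ ⟦ i ⟧ + ⟦ j ⟧
    +-homo (+ m) (+ n) = ×-homo-+ 1# m n
    +-homo (+ m) -[1+ n ] = ⊖-homo m (suc n)
    +-homo -[1+ m ] (+ n) = trans (⊖-homo n (suc m)) (+-comm _ _)
    +-homo -[1+ m ] -[1+ n ] = begin
      - (suc (suc (m ℕ.+ n)) ×′ 1#)       ≈⟨ -‿cong (1+× (suc m ℕ.+ n) 1#) ⟩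
      - (1# + (suc m ℕ.+ n) ×′ 1#)        ≈⟨ -‿cong (+-congˡ (×-homo-+ 1# (suc m) n)) ⟩
      - (1# + (suc m ×′ 1# + n ×′ 1#))    ≈⟨ -‿cong (+-congˡ (+-comm _ _)) ⟩
      - (1# + (n ×′ 1# + suc m ×′ 1#))    ≈⟨ -‿cong (+-assoc 1# _ _) ⟨
      - ((1# + n ×′ 1#) + suc m ×′ 1#)    ≈⟨ -‿cong (+-congʳ (1+× n 1#)) ⟨
      - (suc n ×′ 1# + suc m ×′ 1#)       ≈⟨ -‿cong (+-comm _ _) ⟩
      - (suc m ×′ 1# + suc n ×′ 1#)       ≈⟨ -‿+-comm _ _ ⟨
      - (suc m ×′ 1#) + - (suc n ×′ 1#)   ∎

    -‿homo : ∀ i → ⟦ ℤ.- i ⟧ ≈ - ⟦ i ⟧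
    -‿homo (+ zero) = sym -0#≈0#
    -‿homo (+ suc n) = refl
    -‿homo -[1+ n ] = sym (-‿involutive _)

    ⟦sign⟧ : Sign → Carrier
    ⟦sign⟧ Sign.+ = 1#
    ⟦sign⟧ Sign.- = - 1#

    ◃-homo : ∀ s n → ⟦ s ◃ n ⟧ ≈ ⟦sign⟧ s * n ×′ 1#
    ◃-homo s zero = sym (zeroʳ _)
    ◃-homo Sign.+ (suc n) = sym (*-identityˡ _)
    ◃-homo Sign.- (suc n) = sym (-1*x≈-x _)

    sign-abs : ∀ i → ⟦ i ⟧ ≈ ⟦sign⟧ (ℤ.sign i) * ∣ i ∣ ×′ 1#
    sign-abs (+ zero) = sym (zeroʳ _)
    sign-abs (+ suc n) = sym (*-identityˡ _)
    sign-abs -[1+ n ] = sym (-1*x≈-x _)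

    sign-*-homo : ∀ s t → ⟦sign⟧ (s Sign.* t) ≈ ⟦sign⟧ s * ⟦sign⟧ t
    sign-*-homo Sign.+ t = sym (*-identityˡ _)
    sign-*-homo Sign.- Sign.+ = sym (*-identityʳ _)
    sign-*-homo Sign.- Sign.- = sym (trans (-1*x≈-x _) (-‿involutive _))

    interchange : ∀ a b p q → (a * b) * (p * q) ≈ (a * p) * (b * q)
    interchange a b p q = begin
      (a * b) * (p * q)   ≈⟨ *-assoc a b _ ⟩
      a * (b * (p * q))   ≈⟨ *-congˡ (*-assoc b p q) ⟨
      a * ((b * p) * q)   ≈⟨ *-congˡ (*-congʳ (*-comm b p)) ⟩
      a * ((p * b) * q)   ≈⟨ *-congˡ (*-assoc p b q) ⟩
      a * (p * (b * q))   ≈⟨ *-assoc a p _ ⟨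
      (a * p) * (b * q)   ∎

    *-homo : ∀ i j → ⟦ i ℤ.* j ⟧ ≈ ⟦ i ⟧ * ⟦ j ⟧
    *-homo i j = begin
      ⟦ (ℤ.sign i Sign.* ℤ.sign j) ◃ (∣ i ∣ ℕ.* ∣ j ∣) ⟧
        ≈⟨ ◃-homo (ℤ.sign i Sign.* ℤ.sign j) (∣ i ∣ ℕ.* ∣ j ∣) ⟩
      ⟦sign⟧ (ℤ.sign i Sign.* ℤ.sign j) * (∣ i ∣ ℕ.* ∣ j ∣) ×′ 1#
        ≈⟨ *-cong (sign-*-homo (ℤ.sign i) (ℤ.sign j)) (×1-homo-* ∣ i ∣ ∣ j ∣) ⟩
      (⟦sign⟧ (ℤ.sign i) * ⟦sign⟧ (ℤ.sign j)) * (∣ i ∣ ×′ 1# * ∣ j ∣ ×′ 1#)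
        ≈⟨ interchange _ _ _ _ ⟩
      (⟦sign⟧ (ℤ.sign i) * ∣ i ∣ ×′ 1#) * (⟦sign⟧ (ℤ.sign j) * ∣ j ∣ ×′ 1#)
        ≈⟨ *-cong (sign-abs i) (sign-abs j) ⟨
      ⟦ i ⟧ * ⟦ j ⟧ ∎

    morphism : ℤ.+-*-rawRing ACR.-Raw-AlmostCommutative⟶ ACR.fromCommutativeRing R
    morphism = record
      { ⟦_⟧ = ⟦_⟧ ; +-homo = +-homo ; *-homo = *-homo ; -‿homo = -‿homo
      ; 0-homo = refl ; 1-homo = refl }

    coefficient≟ : ∀ i j → Maybe (⟦ i ⟧ ≈ ⟦ j ⟧)
    coefficient≟ i j with i ℤ.≟ j
    ... | yes i≡j = just (reflexive (≡.cong ⟦_⟧ i≡j))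
    ... | no _ = nothing

  open import Algebra.Solver.Ring ℤ.+-*-rawRing (ACR.fromCommutativeRing R) morphism coefficient≟ public

module Determinant {c ℓ : Level} (R : CommutativeRing c ℓ) where
  open CommutativeRing R hiding (zero)
  open RingDefs R
  open import Algebra.Properties.Ring ring using (-‿involutive; -0#≈0#; -‿+-comm)
  open import Relation.Binary.Reasoning.Setoid setoid
  open IntegerCoefficientSolver R using (solve; _:=_; _:+_; _:*_; _:-_; :-_; con)

  altSum : (K : ℕ) → (Fin K → Carrier) → Carrier
  altSum zero g = 0#
  altSum (suc K) g = g zero - altSum K (λ k → g (suc k))

  sign : ∀ {n} → Fin n → Carrier
  sign zero = 1#
  sign (suc k) = - sign k

  ≡⇒≈ : ∀ {a b : Carrier} → a ≡ b → a ≈ b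
  ≡⇒≈ ≡.refl = refl

  altSum-cong : ∀ K {g h : Fin K → Carrier} → (∀ k → g k ≈ h k) → altSum K g ≈ altSum K h
  altSum-cong zero eq = refl
  altSum-cong (suc K) eq = +-cong (eq zero) (-‿cong (altSum-cong K (λ k → eq (suc k))))

  altSum-linear : ∀ K a b (g h : Fin K → Carrier) →
    altSum K (λ k → a * g k + b * h k) ≈ a * altSum K g + b * altSum K h
  altSum-linear zero a b g h =
    solve 2 (λ a b → con (+ 0) := a :* con (+ 0) :+ b :* con (+ 0)) refl a b
  altSum-linear (suc K) a b g h =
    trans (+-congˡ (-‿cong (altSum-linear K a b (λ k → g (suc k)) (λ k → h (suc k)))))
          (solve 6 (λ a b g h G H → (a :* g :+ b :* h) :- (a :* G :+ b :* H) := a :* (g :- G) :+ b :* (h :- H))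
                 refl a b (g zero) (h zero) _ _)

  altSum-scale : ∀ K a (g : Fin K → Carrier) → altSum K (λ k → a * g k) ≈ a * altSum K g
  altSum-scale zero a g = sym (zeroʳ a)
  altSum-scale (suc K) a g =
    trans (+-congˡ (-‿cong (altSum-scale K a (λ k → g (suc k)))))
          (solve 3 (λ a g G → a :* g :- a :* G := a :* (g :- G)) refl a (g zero) _)

  altSum-zero : ∀ K (g : Fin K → Carrier) → (∀ k → g k ≈ 0#) → altSum K g ≈ 0#
  altSum-zero zero g g≈0 = refl
  altSum-zero (suc K) g g≈0 =
    trans (+-cong (g≈0 zero) (-‿cong (altSum-zero K _ (λ k → g≈0 (suc k))))) (-‿inverseʳ 0#)

  altSum-neg : ∀ K (h : Fin K → Carrier) → altSum K (λ k → - h k) ≈ - altSum K h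
  altSum-neg zero h = sym -0#≈0#
  altSum-neg (suc K) h =
    trans (+-congˡ (-‿cong (altSum-neg K (λ k → h (suc k))))) (-‿+-comm (h zero) _)

  altSum-single : ∀ K (c : Fin (suc K)) (g : Fin (suc K) → Carrier) →
    (∀ k → g (punchIn c k) ≈ 0#) → altSum (suc K) g ≈ sign c * g c
  altSum-single K zero g g≈0 =
    trans (+-congˡ (-‿cong (altSum-zero K _ g≈0)))
          (solve 1 (λ g → g :- con (+ 0) := con (+ 1) :* g) refl (g zero))
  altSum-single (suc K) (suc c) g g≈0 =
    trans (+-cong (g≈0 zero) (-‿cong (altSum-single K c (λ k → g (suc k)) (λ k → g≈0 (suc k)))))
          (solve 2 (λ s g → con (+ 0) :- s :* g := (:- s) :* g) refl (sign c) _)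

  altSum-punch : ∀ K (c : Fin (suc K)) (g : Fin (suc K) → Carrier) (h : Fin K → Carrier) →
    g c ≈ 0# → (∀ k → g (punchIn c k) ≈ (if toℕ k ℕ.<ᵇ toℕ c then h k else - h k)) →
    altSum (suc K) g ≈ altSum K h
  altSum-punch K zero g h gc≈0 eq =
    trans (+-cong gc≈0 (-‿cong (trans (altSum-cong K eq) (altSum-neg K h))))
          (trans (+-identityˡ _) (-‿involutive _))
  altSum-punch (suc K) (suc c) g h gc≈0 eq =
    +-cong (eq zero)
      (-‿cong (altSum-punch K c (λ k → g (suc k)) (λ k → h (suc k)) gc≈0 (λ k → eq (suc k))))

  altSum-pair : ∀ K (c : Fin K) (g : Fin (suc K) → Carrier) → g (inject₁ c) ≈ g (suc c) →
    (∀ k → OffPair c k → g k ≈ 0#) → altSum (suc K) g ≈ 0#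
  altSum-pair (suc K) zero g eq off =
    trans (+-cong eq (-‿cong (+-congˡ (-‿cong (altSum-zero K _ (λ k → off (suc (suc k)) tt))))))
          (solve 1 (λ g → g :- (g :- con (+ 0)) := con (+ 0)) refl (g (suc zero)))
  altSum-pair (suc K) (suc c) g eq off =
    trans (+-cong (off zero tt) (-‿cong (altSum-pair K c (λ k → g (suc k)) eq (λ k → off (suc k)))))
          (-‿inverseʳ 0#)

  cofSum≈altSum : ∀ {N} (M : Matrix (suc N)) K (f : Fin K → Fin (suc N)) →
    cofSum M K f ≈ altSum K (λ k → M zero (f k) * det (minor M (f k)))
  cofSum≈altSum M zero f = refl
  cofSum≈altSum M (suc K) f = +-congˡ (-‿cong (cofSum≈altSum M K (λ k → f (suc k))))

  det-expand : ∀ {N} (M : Matrix (suc N)) → det M ≈ altSum (suc N) (λ k → M zero k * det (minor M k))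
  det-expand {N} M = cofSum≈altSum M (suc N) (λ k → k)

  det-cong : ∀ {N} {M M′ : Matrix N} → (∀ i j → M i j ≈ M′ i j) → det M ≈ det M′
  det-cong {zero} eq = refl
  det-cong {suc N} {M} {M′} eq = begin
    det M                                            ≈⟨ det-expand M ⟩
    altSum (suc N) (λ k → M zero k * det (minor M k))
      ≈⟨ altSum-cong (suc N) (λ k → *-cong (eq zero k) (det-cong (λ i j → eq (suc i) (punchIn k j)))) ⟩
    altSum (suc N) (λ k → M′ zero k * det (minor M′ k)) ≈⟨ det-expand M′ ⟨
    det M′                                           ∎

  det-zero-column : ∀ {N} (M : Matrix N) (c : Fin N) → (∀ i → M i c ≈ 0#) → det M ≈ 0#
  det-zero-column {suc N} M c col≈0 = begin
    det M                                             ≈⟨ det-expand M ⟩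
    altSum (suc N) (λ k → M zero k * det (minor M k)) ≈⟨ altSum-single N c (λ k → M zero k * det (minor M k)) other≈0 ⟩
    sign c * (M zero c * det (minor M c))             ≈⟨ *-congˡ (trans (*-congʳ (col≈0 zero)) (zeroˡ _)) ⟩
    sign c * 0#                                       ≈⟨ zeroʳ _ ⟩
    0#                                                ∎
    where
    other≈0 : ∀ k → M zero (punchIn c k) * det (minor M (punchIn c k)) ≈ 0#
    other≈0 k = trans (*-congˡ (det-zero-column (minor M (punchIn c k)) (pivotAfter c k)
                  (λ i → trans (≡⇒≈ (≡.cong (M (suc i)) (punchIn-pivotAfter c k))) (col≈0 (suc i)))))
                (zeroʳ _)

  det-linear-column : ∀ {N} (M M₁ M₂ : Matrix (suc N)) (c : Fin (suc N)) (a b : Carrier) →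
    (∀ i k → M i (punchIn c k) ≈ M₁ i (punchIn c k)) →
    (∀ i k → M i (punchIn c k) ≈ M₂ i (punchIn c k)) →
    (∀ i → M i c ≈ a * M₁ i c + b * M₂ i c) →
    det M ≈ a * det M₁ + b * det M₂
  det-linear-column {zero} M M₁ M₂ zero a b _ _ col =
    trans (+-congʳ (*-congʳ (col zero)))
      (solve 4 (λ a b p q → (a :* p :+ b :* q) :* con (+ 1) :- con (+ 0)
                          := a :* (p :* con (+ 1) :- con (+ 0)) :+ b :* (q :* con (+ 1) :- con (+ 0)))
             refl a b (M₁ zero zero) (M₂ zero zero))
  det-linear-column {suc N} M M₁ M₂ c a b same₁ same₂ col = begin
    det M                                           ≈⟨ det-expand M ⟩
    altSum (suc (suc N)) (λ k → M zero k * det (minor M k)) ≈⟨ altSum-cong (suc (suc N)) term ⟩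
    altSum (suc (suc N)) (λ k → a * t₁ k + b * t₂ k) ≈⟨ altSum-linear (suc (suc N)) a b t₁ t₂ ⟩
    a * altSum (suc (suc N)) t₁ + b * altSum (suc (suc N)) t₂
      ≈⟨ +-cong (*-congˡ (det-expand M₁)) (*-congˡ (det-expand M₂)) ⟨
    a * det M₁ + b * det M₂                         ∎
    where
    t₁ t₂ : Fin (suc (suc N)) → Carrier
    t₁ k = M₁ zero k * det (minor M₁ k)
    t₂ k = M₂ zero k * det (minor M₂ k)
    term : ∀ k → M zero k * det (minor M k) ≈ a * t₁ k + b * t₂ k
    term k with punchIn-cases c k
    ... | inj₁ ≡.refl = begin
      M zero c * det (minor M c)                              ≈⟨ *-congʳ (col zero) ⟩
      (a * M₁ zero c + b * M₂ zero c) * det (minor M c)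
        ≈⟨ solve 5 (λ a b p q d → (a :* p :+ b :* q) :* d := a :* (p :* d) :+ b :* (q :* d)) refl a b _ _ _ ⟩
      a * (M₁ zero c * det (minor M c)) + b * (M₂ zero c * det (minor M c))
        ≈⟨ +-cong (*-congˡ (*-congˡ (det-cong (λ i l → same₁ (suc i) l))))
                  (*-congˡ (*-congˡ (det-cong (λ i l → same₂ (suc i) l)))) ⟩
      a * t₁ c + b * t₂ c                                     ∎
    ... | inj₂ (k′ , ≡.refl) = begin
      M zero k * det (minor M k)
        ≈⟨ *-congˡ (det-linear-column (minor M k) (minor M₁ k) (minor M₂ k) (pivotAfter c k′) a b
                      (λ i l → minor-agrees {M₁} same₁ (suc i) l) (λ i l → minor-agrees {M₂} same₂ (suc i) l)
                      pivot-col) ⟩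
      M zero k * (a * det (minor M₁ k) + b * det (minor M₂ k))
        ≈⟨ solve 5 (λ m a b d₁ d₂ → m :* (a :* d₁ :+ b :* d₂) := a :* (m :* d₁) :+ b :* (m :* d₂))
                 refl (M zero k) a b _ _ ⟩
      a * (M zero k * det (minor M₁ k)) + b * (M zero k * det (minor M₂ k))
        ≈⟨ +-cong (*-congˡ (*-congʳ (same₁ zero k′))) (*-congˡ (*-congʳ (same₂ zero k′))) ⟩
      a * t₁ k + b * t₂ k ∎
      where
      minor-agrees : ∀ {M′ : Matrix (suc (suc N))} → (∀ i k → M i (punchIn c k) ≈ M′ i (punchIn c k)) →
        ∀ i l → M i (punchIn k (punchIn (pivotAfter c k′) l)) ≈ M′ i (punchIn k (punchIn (pivotAfter c k′) l))
      minor-agrees {M′} same i l rewrite punchIn-punchIn-pivotAfter c k′ l = same i (punchIn k′ l)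
      pivot-col : ∀ i → M (suc i) (punchIn k (pivotAfter c k′))
                        ≈ a * M₁ (suc i) (punchIn k (pivotAfter c k′)) + b * M₂ (suc i) (punchIn k (pivotAfter c k′))
      pivot-col i rewrite punchIn-pivotAfter c k′ = col (suc i)

  det-adjacent-equal-columns : ∀ {N} (M : Matrix (suc N)) (c : Fin N) →
    (∀ i → M i (inject₁ c) ≈ M i (suc c)) → det M ≈ 0#
  det-adjacent-equal-columns {suc N} M c equal = begin
    det M                                                    ≈⟨ det-expand M ⟩
    altSum (suc (suc N)) (λ k → M zero k * det (minor M k)) ≈⟨ altSum-pair (suc N) c _ pair-terms off-terms ⟩
    0#                                                       ∎
    where
    minors : ∀ i l → M (suc i) (punchIn (inject₁ c) l) ≈ M (suc i) (punchIn (suc c) l)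
    minors i l with punchIn-pair c l
    ... | inj₁ eq = ≡⇒≈ (≡.cong (M (suc i)) eq)
    ... | inj₂ (eq₁ , eq₂) rewrite eq₁ | eq₂ = sym (equal (suc i))
    pair-terms : M zero (inject₁ c) * det (minor M (inject₁ c)) ≈ M zero (suc c) * det (minor M (suc c))
    pair-terms = *-cong (equal zero) (det-cong minors)
    off-terms : ∀ k → OffPair c k → M zero k * det (minor M k) ≈ 0#
    off-terms k off with punchIn-OffPair c k off
    ... | c′ , eq₁ , eq₂ = trans (*-congˡ (det-adjacent-equal-columns (minor M k) c′ equal′)) (zeroʳ _)
      where
      equal′ : ∀ i → M (suc i) (punchIn k (inject₁ c′)) ≈ M (suc i) (punchIn k (suc c′))
      equal′ i rewrite eq₁ | eq₂ = equal (suc i)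

  deleteRowCol : ∀ {N} → Fin (suc N) → Fin (suc N) → Matrix (suc N) → Matrix N
  deleteRowCol r c M i k = M (punchIn r i) (punchIn c k)

  sign-pivotAfter : ∀ {n} (c : Fin (suc n)) (k : Fin n) →
    sign (pivotAfter c k) ≈ (if toℕ k ℕ.<ᵇ toℕ c then - sign c else sign c)
  sign-pivotAfter zero zero = refl
  sign-pivotAfter zero (suc k) = refl
  sign-pivotAfter (suc c) zero = sym (-‿involutive _)
  sign-pivotAfter (suc c) (suc k) with toℕ k ℕ.<ᵇ toℕ c | sign-pivotAfter c k
  ... | true | eq = -‿cong eq
  ... | false | eq = -‿cong eq

  cofactor-sign : ∀ b (m ρ γ σ e d : Carrier) → σ ≈ (if b then - γ else γ) →
    m * (ρ * σ * e * d) ≈ (if b then (- ρ) * γ * e * (m * d) else - ((- ρ) * γ * e * (m * d)))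
  cofactor-sign true m ρ γ σ e d σ≈ = trans (*-congˡ (*-congʳ (*-congʳ (*-congˡ σ≈))))
    (solve 5 (λ m ρ γ e d → m :* (ρ :* (:- γ) :* e :* d) := (:- ρ) :* γ :* e :* (m :* d)) refl m ρ γ e d)
  cofactor-sign false m ρ γ σ e d σ≈ = trans (*-congˡ (*-congʳ (*-congʳ (*-congˡ σ≈))))
    (solve 5 (λ m ρ γ e d → m :* (ρ :* γ :* e :* d) := :- ((:- ρ) :* γ :* e :* (m :* d))) refl m ρ γ e d)

  det-single-entry-column : ∀ {N} (M : Matrix (suc N)) (r c : Fin (suc N)) →
    (∀ i → M (punchIn r i) c ≈ 0#) → det M ≈ sign r * sign c * M r c * det (deleteRowCol r c M)
  det-single-entry-column {N} M zero c col≈0 = begin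
    det M                                             ≈⟨ det-expand M ⟩
    altSum (suc N) (λ k → M zero k * det (minor M k))
      ≈⟨ altSum-single N c (λ k → M zero k * det (minor M k)) other≈0 ⟩
    sign c * (M zero c * det (minor M c))
      ≈⟨ solve 3 (λ s m d → s :* (m :* d) := con (+ 1) :* s :* m :* d) refl (sign c) _ _ ⟩
    1# * sign c * M zero c * det (minor M c)          ∎
    where
    other≈0 : ∀ k → M zero (punchIn c k) * det (minor M (punchIn c k)) ≈ 0#
    other≈0 k = trans (*-congˡ (det-zero-column (minor M (punchIn c k)) (pivotAfter c k)
                  (λ i → trans (≡⇒≈ (≡.cong (M (suc i)) (punchIn-pivotAfter c k))) (col≈0 i))))
                (zeroʳ _)
  det-single-entry-column {suc N} M (suc r) c col≈0 = begin
    det M                                      ≈⟨ det-expand M ⟩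
    altSum (suc (suc N)) (λ k → M zero k * det (minor M k))
      ≈⟨ altSum-punch (suc N) c (λ k → M zero k * det (minor M k)) h
           (trans (*-congʳ (col≈0 zero)) (zeroˡ _)) term ⟩
    altSum (suc N) h                           ≈⟨ altSum-scale (suc N) s (λ k → D zero k * det (minor D k)) ⟩
    s * altSum (suc N) (λ k → D zero k * det (minor D k)) ≈⟨ *-congˡ (det-expand D) ⟨
    s * det D                                  ∎
    where
    D : Matrix (suc N)
    D = deleteRowCol (suc r) c M
    s : Carrier
    s = sign (suc r) * sign c * M (suc r) c
    h : Fin (suc N) → Carrier
    h k = s * (D zero k * det (minor D k))
    term : ∀ k → M zero (punchIn c k) * det (minor M (punchIn c k)) ≈ (if toℕ k ℕ.<ᵇ toℕ c then h k else - h k)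
    term k = trans (*-congˡ minor-expansion) (cofactor-sign _ _ (sign r) (sign c) _ _ _ (sign-pivotAfter c k))
      where
      pivot-col : ∀ i → minor M (punchIn c k) (punchIn r i) (pivotAfter c k) ≈ 0#
      pivot-col i rewrite punchIn-pivotAfter c k = col≈0 (suc i)
      minor-expansion : det (minor M (punchIn c k)) ≈ sign r * sign (pivotAfter c k) * M (suc r) c * det (minor D k)
      minor-expansion = begin
        det (minor M (punchIn c k))
          ≈⟨ det-single-entry-column (minor M (punchIn c k)) r (pivotAfter c k) pivot-col ⟩
        sign r * sign (pivotAfter c k) * M (suc r) (punchIn (punchIn c k) (pivotAfter c k))
          * det (deleteRowCol r (pivotAfter c k) (minor M (punchIn c k)))
          ≈⟨ *-cong (*-congˡ (≡⇒≈ (≡.cong (M (suc r)) (punchIn-pivotAfter c k))))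
                    (det-cong (λ i l → ≡⇒≈ (≡.cong (M (suc (punchIn r i))) (punchIn-punchIn-pivotAfter c k l)))) ⟩
        sign r * sign (pivotAfter c k) * M (suc r) c * det (minor D k) ∎

  sign-squared : ∀ {n} (c : Fin n) → sign c * sign c ≈ 1#
  sign-squared zero = *-identityˡ 1#
  sign-squared (suc c) = trans (solve 1 (λ s → (:- s) :* (:- s) := s :* s) refl (sign c)) (sign-squared c)

  det-diagonal-split : ∀ {N} (M M′ : Matrix (suc N)) (c : Fin (suc N)) →
    (∀ i k → M i (punchIn c k) ≈ M′ i (punchIn c k)) →
    (∀ k → M (punchIn c k) c ≈ M′ (punchIn c k) c) →
    det M ≈ det M′ + (M c c - M′ c c) * det (deleteRowCol c c M)
  det-diagonal-split M M′ c same-off same-col = begin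
    det M                     ≈⟨ det-linear-column M M′ E c 1# δ same-off same-E col ⟩
    1# * det M′ + δ * det E   ≈⟨ +-cong (*-identityˡ _) (*-congˡ det-E) ⟩
    det M′ + δ * det (deleteRowCol c c M) ∎
    where
    δ : Carrier
    δ = M c c - M′ c c
    E : Matrix _
    E i j = if ⌊ j ≟ c ⌋ then identity i c else M i j
    same-E : ∀ i k → M i (punchIn c k) ≈ E i (punchIn c k)
    same-E i k rewrite ⌊punchIn≟pivot⌋ c k = refl
    col : ∀ i → M i c ≈ 1# * M′ i c + δ * E i c
    col i with punchIn-cases c i
    ... | inj₁ ≡.refl rewrite ⌊≟⌋-refl c =
      solve 2 (λ m m′ → m := con (+ 1) :* m′ :+ (m :- m′) :* con (+ 1)) refl (M c c) (M′ c c)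
    ... | inj₂ (k , ≡.refl) rewrite ⌊≟⌋-refl c | ⌊punchIn≟pivot⌋ c k =
      trans (same-col k) (solve 2 (λ m′ d → m′ := con (+ 1) :* m′ :+ d :* con (+ 0)) refl (M′ (punchIn c k) c) δ)
    E-pivot : E c c ≈ 1#
    E-pivot rewrite ⌊≟⌋-refl c = refl
    E-off : ∀ k → E (punchIn c k) c ≈ 0#
    E-off k rewrite ⌊≟⌋-refl c | ⌊punchIn≟pivot⌋ c k = refl
    det-E : det E ≈ det (deleteRowCol c c M)
    det-E = begin
      det E                                              ≈⟨ det-single-entry-column E c c E-off ⟩
      sign c * sign c * E c c * det (deleteRowCol c c E)
        ≈⟨ *-cong (*-cong (sign-squared c) E-pivot) (det-cong (λ i k → sym (same-E (punchIn c i) k))) ⟩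
      1# * 1# * det (deleteRowCol c c M)                 ≈⟨ trans (*-congʳ (*-identityˡ 1#)) (*-identityˡ _) ⟩
      det (deleteRowCol c c M)                           ∎

module LabelledMatrix {c ℓ : Level} (R : CommutativeRing c ℓ) {a} {K : Set a}
  (off : K → K → CommutativeRing.Carrier R) where
  open CommutativeRing R hiding (zero)
  open RingDefs R
  open Determinant R
  open import Relation.Binary.Reasoning.Setoid setoid

  Vertex : Set (a ⊔ c)
  Vertex = K × Carrier

  labelled : ∀ {N} → (Fin N → Vertex) → Matrix N
  labelled v i j = if ⌊ i ≟ j ⌋ then proj₂ (v i) else off (proj₁ (v i)) (proj₁ (v j))

  labelled-cong : ∀ {N} {v w : Fin N → Vertex} → (∀ i → v i ≡ w i) → det (labelled v) ≈ det (labelled w)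
  labelled-cong {v = v} {w} v≡w = det-cong entries
    where
    entries : ∀ i j → labelled v i j ≈ labelled w i j
    entries i j rewrite v≡w i | v≡w j = refl

  labelled-split : ∀ {N} (v w : Fin (suc N) → Vertex) (c : Fin (suc N)) →
    proj₁ (w c) ≡ proj₁ (v c) → (∀ k → w (punchIn c k) ≡ v (punchIn c k)) →
    det (labelled v) ≈ det (labelled w) + (proj₂ (v c) - proj₂ (w c)) * det (labelled (v ∘ punchIn c))
  labelled-split v w c same-label same-off = begin
    det (labelled v)
      ≈⟨ det-diagonal-split (labelled v) (labelled w) c off-columns pivot-column ⟩
    det (labelled w) + (labelled v c c - labelled w c c) * det (deleteRowCol c c (labelled v))
      ≈⟨ +-congˡ (*-cong pivot deleted) ⟩
    det (labelled w) + (proj₂ (v c) - proj₂ (w c)) * det (labelled (v ∘ punchIn c)) ∎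
    where
    off-columns : ∀ i k → labelled v i (punchIn c k) ≈ labelled w i (punchIn c k)
    off-columns i k with punchIn-cases c i
    ... | inj₁ ≡.refl rewrite ⌊pivot≟punchIn⌋ c k | same-label | same-off k = refl
    ... | inj₂ (i′ , ≡.refl) rewrite same-off i′ | same-off k = refl
    pivot-column : ∀ k → labelled v (punchIn c k) c ≈ labelled w (punchIn c k) c
    pivot-column k rewrite ⌊punchIn≟pivot⌋ c k | same-label | same-off k = refl
    pivot : labelled v c c - labelled w c c ≈ proj₂ (v c) - proj₂ (w c)
    pivot rewrite ⌊≟⌋-refl c = refl
    deleted : det (deleteRowCol c c (labelled v)) ≈ det (labelled (v ∘ punchIn c))
    deleted = det-cong entries
      where
      entries : ∀ i j → deleteRowCol c c (labelled v) i j ≈ labelled (v ∘ punchIn c) i j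
      entries i j rewrite ⌊punchIn≟punchIn⌋ c i j = refl

  labelled-insertAt : ∀ {N} (T : Vec Vertex N) (c : Fin (suc N)) (k : K) (d e : Carrier) →
    det (labelled (lookup (insertAt T c (k , d))))
      ≈ det (labelled (lookup (insertAt T c (k , e)))) + (d - e) * det (labelled (lookup T))
  labelled-insertAt T c k d e = begin
    det (labelled (lookup (insertAt T c (k , d))))
      ≈⟨ labelled-split (lookup (insertAt T c (k , d))) (lookup (insertAt T c (k , e))) c
           (≡.trans (≡.cong proj₁ (insertAt-lookup T c (k , e))) (≡.sym (≡.cong proj₁ (insertAt-lookup T c (k , d)))))
           (λ j → ≡.trans (insertAt-punchIn T c (k , e) j) (≡.sym (insertAt-punchIn T c (k , d) j))) ⟩
    det (labelled (lookup (insertAt T c (k , e))))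
      + (proj₂ (lookup (insertAt T c (k , d)) c) - proj₂ (lookup (insertAt T c (k , e)) c))
      * det (labelled (lookup (insertAt T c (k , d)) ∘ punchIn c))
      ≈⟨ +-congˡ (*-cong (≡⇒≈ (≡.cong₂ (λ u w → proj₂ u - proj₂ w)
                                         (insertAt-lookup T c (k , d)) (insertAt-lookup T c (k , e))))
                         (labelled-cong (insertAt-punchIn T c (k , d)))) ⟩
    det (labelled (lookup (insertAt T c (k , e)))) + (d - e) * det (labelled (lookup T)) ∎

  labelled-twins : ∀ {N} (v : Fin (suc N) → Vertex) (c : Fin N) → v (inject₁ c) ≡ v (suc c) →
    proj₂ (v (suc c)) ≈ off (proj₁ (v (suc c))) (proj₁ (v (suc c))) → det (labelled v) ≈ 0#
  labelled-twins v c twin diag≈off = det-adjacent-equal-columns (labelled v) c columns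
    where
    columns : ∀ j → labelled v j (inject₁ c) ≈ labelled v j (suc c)
    columns j with j ≟ inject₁ c | j ≟ suc c
    ... | yes ≡.refl | yes eq = contradiction eq (inject₁≢suc c)
    ... | yes ≡.refl | no _ rewrite twin = diag≈off
    ... | no _ | yes ≡.refl rewrite twin = sym diag≈off
    ... | no _ | no _ rewrite twin = refl

-- (lies in the first star, is a centre), as computed by first? and centre?
Kind : Set
Kind = Bool × Bool

centre₁ leaf₁ centre₂ leaf₂ : Kind
centre₁ = true , true
leaf₁ = true , false
centre₂ = false , true
leaf₂ = false , false

kind : ∀ n → Fin (n ℕ.+ n) → Kind
kind n i = first? n i , centre? n i

sameStar : Kind → Kind → Bool
sameStar (f , _) (f′ , _) = if f then f′ else not f′

-- Distinct vertices are adjacent in the complement of S_{n,n} plus the edge v₁v₂.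
adjacent : Kind → Kind → Bool
adjacent κ@(_ , c) κ′@(_ , c′) =
  not ((sameStar κ κ′ ∧ (c ∨ c′)) ∨ (not (sameStar κ κ′) ∧ c ∧ c′)) ∨ (c ∧ c′)

-- first? and centre? are stuck on an open index, whereas _<ᵇ_ and _≡ᵇ_ compute by recursion.
kind-toℕ : ∀ n (i : Fin (n ℕ.+ n)) → kind n i ≡ ((toℕ i <ᵇ n) , (toℕ i ≡ᵇ 0) ∨ (toℕ i ≡ᵇ n))
kind-toℕ n i = ≡.cong₂ _,_ (isYes≗does (toℕ i ℕ.<? n))
  (≡.cong₂ _∨_ (isYes≗does (toℕ i ℕ.≟ 0)) (isYes≗does (toℕ i ℕ.≟ n)))

layout : ∀ {a} {A : Set a} (m : ℕ) → A → Vec (Kind × A) (suc m ℕ.+ suc m)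
layout m x = (centre₁ , x) ∷ (replicate m (leaf₁ , x) ++ (centre₂ , x) ∷ replicate m (leaf₂ , x))

lookup-layout : ∀ {a} {A : Set a} m (x : A) (i : Fin (suc m ℕ.+ suc m)) → lookup (layout m x) i ≡ (kind (suc m) i , x)
lookup-layout m x zero = ≡.cong (_, x) (≡.sym (kind-toℕ (suc m) zero))
lookup-layout m x (suc i) = ≡.trans (after-centre₁ m i) (≡.cong (_, x) (≡.sym (kind-toℕ (suc m) (suc i))))
  where
  after-centre₁ : ∀ a {q} (j : Fin (a ℕ.+ suc q)) →
    lookup (replicate a (leaf₁ , x) ++ (centre₂ , x) ∷ replicate q (leaf₂ , x)) j
      ≡ (((toℕ j <ᵇ a) , (toℕ j ≡ᵇ a)) , x)
  after-centre₁ zero zero = ≡.refl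
  after-centre₁ zero (suc j) = lookup-replicate j (leaf₂ , x)
  after-centre₁ (suc a) zero = ≡.refl
  after-centre₁ (suc a) (suc j) = after-centre₁ a j

module CharacteristicPolynomial {c ℓ : Level} (R : CommutativeRing c ℓ) where
  open CommutativeRing R hiding (zero)
  open RingDefs R
  open Determinant R using (det-cong)
  open IntegerCoefficientSolver R using (solve; _:=_; _:+_; _:*_; _:-_; :-_; con; Polynomial)
  open import Relation.Binary.Reasoning.Setoid setoid

  off : Kind → Kind → Carrier
  off κ κ′ = if adjacent κ κ′ then - 1# else 0#

  open LabelledMatrix R off

  charMatrix≈labelled : ∀ n x (i j : Fin (n ℕ.+ n)) →
    x * identity i j - adjacency (SbarPlus n n) i j ≈ labelled (λ k → kind n k , x) i j
  charMatrix≈labelled n x i j with i ≟ j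
  ... | yes _ rewrite ∧-zeroʳ (centre? n j) | ∧-zeroʳ (centre? n i) =
    solve 1 (λ x → x :* con (+ 1) :- con (+ 0) := x) refl x
  ... | no _ rewrite ∧-identityʳ (centre? n j) with adjacent (kind n i) (kind n j)
  ...   | true = solve 1 (λ x → x :* con (+ 0) :- con (+ 1) := :- con (+ 1)) refl x
  ...   | false = solve 1 (λ x → x :* con (+ 0) :- con (+ 0) := con (+ 0)) refl x

  pow-+ : ∀ a p q → pow a (p ℕ.+ q) ≈ pow a p * pow a q
  pow-+ a zero q = sym (*-identityˡ _)
  pow-+ a (suc p) q = trans (*-congˡ (pow-+ a p q)) (sym (*-assoc _ _ _))

  leaf-recurrence : ∀ (F G : ℕ → Carrier) δ →
    (∀ a → F (suc a) ≈ G a + δ * F a) → (∀ a → G (suc a) ≈ δ * G a) →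
    ∀ a → F (suc a) ≈ pow δ a * (F 1 + nat a * G 0)
  leaf-recurrence F G δ F-step G-step = F-closed
    where
    G-closed : ∀ a → G a ≈ pow δ a * G 0
    G-closed zero = sym (*-identityˡ _)
    G-closed (suc a) = trans (G-step a) (trans (*-congˡ (G-closed a)) (sym (*-assoc _ _ _)))
    F-closed : ∀ a → F (suc a) ≈ pow δ a * (F 1 + nat a * G 0)
    F-closed zero = solve 2 (λ f g → f := con (+ 1) :* (f :+ con (+ 0) :* g)) refl (F 1) (G 0)
    F-closed (suc a) = begin
      F (suc (suc a))                                          ≈⟨ F-step (suc a) ⟩
      G (suc a) + δ * F (suc a)                                ≈⟨ +-cong (G-closed (suc a)) (*-congˡ (F-closed a)) ⟩
      δ * pow δ a * G 0 + δ * (pow δ a * (F 1 + nat a * G 0))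
        ≈⟨ solve 5 (λ δ P f g k → δ :* P :* g :+ δ :* (P :* (f :+ k :* g)) := δ :* P :* (f :+ (con (+ 1) :+ k) :* g))
                 refl δ (pow δ a) (F 1) (G 0) (nat a) ⟩
      pow δ (suc a) * (F 1 + nat (suc a) * G 0)               ∎

  -- det on solver syntax: its value is definitionally det, so the solver can expand small determinants.
  private
    detPoly : ∀ {N} → (Fin N → Fin N → Polynomial 1) → Polynomial 1
    cofSumPoly : ∀ {N} → (Fin (suc N) → Fin (suc N) → Polynomial 1) → (K : ℕ) → (Fin K → Fin (suc N)) → Polynomial 1
    detPoly {zero} M = con (+ 1)
    detPoly {suc N} M = cofSumPoly M (suc N) (λ j → j)
    cofSumPoly M zero f = con (+ 0)
    cofSumPoly M (suc K) f =
      M zero (f zero) :* detPoly (λ r k → M (suc r) (punchIn (f zero) k)) :- cofSumPoly M K (λ j → f (suc j))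

    labelledPoly : ∀ {N} → Vec (Kind × Polynomial 1) N → Fin N → Fin N → Polynomial 1
    labelledPoly v i j =
      if ⌊ i ≟ j ⌋ then proj₂ (lookup v i)
      else (if adjacent (proj₁ (lookup v i)) (proj₁ (lookup v j)) then :- con (+ 1) else con (+ 0))

  module _ (x : Carrier) where
    twin-step : ∀ {N} (T : Vec Vertex (suc N)) (c : Fin (suc N)) κ →
      lookup (insertAt T (suc c) (κ , - 1#)) (inject₁ c) ≡ (κ , - 1#) → off κ κ ≈ - 1# →
      det (labelled (lookup (insertAt T (suc c) (κ , x)))) ≈ (x - - 1#) * det (labelled (lookup T))
    twin-step {N} T c κ twin off≈-1 = begin
      det (labelled (lookup (insertAt T (suc c) (κ , x))))
        ≈⟨ labelled-insertAt T (suc c) κ x (- 1#) ⟩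
      det (labelled (lookup T′)) + (x - - 1#) * det (labelled (lookup T))
        ≈⟨ +-congʳ (labelled-twins (lookup T′) c (≡.trans twin (≡.sym (insertAt-lookup T (suc c) (κ , - 1#))))
                      diag≈off) ⟩
      0# + (x - - 1#) * det (labelled (lookup T))   ≈⟨ +-identityˡ _ ⟩
      (x - - 1#) * det (labelled (lookup T))        ∎
      where
      T′ : Vec Vertex (suc (suc N))
      T′ = insertAt T (suc c) (κ , - 1#)
      diag≈off : proj₂ (lookup T′ (suc c)) ≈ off (proj₁ (lookup T′ (suc c))) (proj₁ (lookup T′ (suc c)))
      diag≈off rewrite insertAt-lookup T (suc c) (κ , - 1#) = sym off≈-1

    F₁ G₁ : ∀ {r} → Vec Vertex r → ℕ → Carrier
    F₁ S a = det (labelled (lookup ((centre₁ , x) ∷ (replicate a (leaf₁ , x) ++ S))))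
    G₁ S a = det (labelled (lookup ((centre₁ , x) ∷ (leaf₁ , - 1#) ∷ (replicate a (leaf₁ , x) ++ S))))

    first-star-leaves : ∀ {r} (S : Vec Vertex r) a → F₁ S (suc a) ≈ pow (x - - 1#) a * (F₁ S 1 + nat a * G₁ S 0)
    first-star-leaves S = leaf-recurrence (F₁ S) (G₁ S) (x - - 1#)
      (λ a → labelled-insertAt ((centre₁ , x) ∷ (replicate a (leaf₁ , x) ++ S)) (suc zero) leaf₁ x (- 1#))
      (λ a → twin-step ((centre₁ , x) ∷ (leaf₁ , - 1#) ∷ (replicate a (leaf₁ , x) ++ S)) (suc zero) leaf₁ ≡.refl refl)

    F₂ G₂ : Vertex → ℕ → Carrier
    F₂ t a = det (labelled (lookup ((centre₁ , x) ∷ t ∷ (centre₂ , x) ∷ replicate a (leaf₂ , x))))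
    G₂ t a = det (labelled (lookup ((centre₁ , x) ∷ t ∷ (centre₂ , x) ∷ (leaf₂ , - 1#) ∷ replicate a (leaf₂ , x))))

    second-star-leaves : ∀ t a → F₂ t (suc a) ≈ pow (x - - 1#) a * (F₂ t 1 + nat a * G₂ t 0)
    second-star-leaves t = leaf-recurrence (F₂ t) (G₂ t) (x - - 1#)
      (λ a → labelled-insertAt ((centre₁ , x) ∷ t ∷ (centre₂ , x) ∷ replicate a (leaf₂ , x)) third leaf₂ x (- 1#))
      (λ a → twin-step ((centre₁ , x) ∷ t ∷ (centre₂ , x) ∷ (leaf₂ , - 1#) ∷ replicate a (leaf₂ , x)) third leaf₂
                       ≡.refl refl)
      where
      third : ∀ {n} → Fin (suc (suc (suc (suc n))))
      third = suc (suc (suc zero))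

    det-leaf₁-leaf₂ : F₂ (leaf₁ , x) 1 ≈ x * x * x * x - (1# + 1# + 1# + 1#) * x * x
    det-leaf₁-leaf₂ = solve 1 (λ X →
      detPoly (labelledPoly ((centre₁ , X) ∷ (leaf₁ , X) ∷ (centre₂ , X) ∷ (leaf₂ , X) ∷ []))
        := X :* X :* X :* X :- con (+ 4) :* X :* X) refl x

    det-leaf₁-twin₂ : G₂ (leaf₁ , x) 0 ≈ - (x * x * x) - (1# + 1#) * x * x + (1# + 1#) * x
    det-leaf₁-twin₂ = solve 1 (λ X →
      detPoly (labelledPoly ((centre₁ , X) ∷ (leaf₁ , X) ∷ (centre₂ , X) ∷ (leaf₂ , :- con (+ 1)) ∷ []))
        := :- (X :* X :* X) :- con (+ 2) :* X :* X :+ con (+ 2) :* X) refl x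

    det-twin₁-leaf₂ : F₂ (leaf₁ , - 1#) 1 ≈ - (x * x * x) - (1# + 1#) * x * x + (1# + 1#) * x
    det-twin₁-leaf₂ = solve 1 (λ X →
      detPoly (labelledPoly ((centre₁ , X) ∷ (leaf₁ , :- con (+ 1)) ∷ (centre₂ , X) ∷ (leaf₂ , X) ∷ []))
        := :- (X :* X :* X) :- con (+ 2) :* X :* X :+ con (+ 2) :* X) refl x

    det-twin₁-twin₂ : G₂ (leaf₁ , - 1#) 0 ≈ (1# + 1#) * x - 1#
    det-twin₁-twin₂ = solve 1 (λ X →
      detPoly (labelledPoly ((centre₁ , X) ∷ (leaf₁ , :- con (+ 1)) ∷ (centre₂ , X) ∷ (leaf₂ , :- con (+ 1)) ∷ []))
        := con (+ 2) :* X :- con (+ 1)) refl x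

  twice-minus-four : ∀ a → 2 *ℕ suc (suc a) ∸ 4 ≡ a ℕ.+ a
  twice-minus-four a rewrite ℕ.+-suc a (suc (a ℕ.+ 0)) | ℕ.+-suc a (a ℕ.+ 0) | ℕ.+-identityʳ a = ≡.refl

  charPoly-SbarPlus : ∀ a x → let n = suc (suc a) in
    charPoly (adjacency (SbarPlus n n)) x
      ≈ ((x - (nat n - 1#)) * (x - (nat n - 1#)) - (nat n * nat n - nat 3 * nat n + nat 3))
        * ((x - - 1#) * (x - - 1#) - (nat n - 1#)) * pow (x - - 1#) (2 *ℕ n ∸ 4)
  charPoly-SbarPlus a x = begin
    charPoly (adjacency (SbarPlus n n)) x          ≈⟨ det-cong (charMatrix≈labelled n x) ⟩
    det (labelled (λ k → kind n k , x))           ≈⟨ labelled-cong (λ k → ≡.sym (lookup-layout (suc a) x k)) ⟩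
    F₁ x ((centre₂ , x) ∷ replicate (suc a) (leaf₂ , x)) (suc a)
      ≈⟨ first-star-leaves x _ a ⟩
    P * (F₂ x (leaf₁ , x) (suc a) + nat a * F₂ x (leaf₁ , - 1#) (suc a))
      ≈⟨ *-congˡ (+-cong (second-star-leaves x _ a) (*-congˡ (second-star-leaves x _ a))) ⟩
    P * (P * (F₂ x (leaf₁ , x) 1 + nat a * G₂ x (leaf₁ , x) 0)
         + nat a * (P * (F₂ x (leaf₁ , - 1#) 1 + nat a * G₂ x (leaf₁ , - 1#) 0)))
      ≈⟨ *-congˡ (+-cong (*-congˡ (+-cong (det-leaf₁-leaf₂ x) (*-congˡ (det-leaf₁-twin₂ x))))
                         (*-congˡ (*-congˡ (+-cong (det-twin₁-leaf₂ x) (*-congˡ (det-twin₁-twin₂ x)))))) ⟩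
    P * (P * (x * x * x * x - (1# + 1# + 1# + 1#) * x * x + nat a * (- (x * x * x) - (1# + 1#) * x * x + (1# + 1#) * x))
         + nat a * (P * (- (x * x * x) - (1# + 1#) * x * x + (1# + 1#) * x + nat a * ((1# + 1#) * x - 1#))))
      ≈⟨ solve 3 (λ x m P →
           P :* (P :* (x :* x :* x :* x :- con (+ 4) :* x :* x :+ m :* (:- (x :* x :* x) :- con (+ 2) :* x :* x :+ con (+ 2) :* x))
                 :+ m :* (P :* (:- (x :* x :* x) :- con (+ 2) :* x :* x :+ con (+ 2) :* x :+ m :* (con (+ 2) :* x :- con (+ 1)))))
           := ((x :- (2+ m :- con (+ 1))) :* (x :- (2+ m :- con (+ 1))) :- (2+ m :* 2+ m :- three :* 2+ m :+ three))
              :* ((x :- :- con (+ 1)) :* (x :- :- con (+ 1)) :- (2+ m :- con (+ 1))) :* (P :* P))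
           refl x (nat a) P ⟩
    Q * (P * P)                                    ≈⟨ *-congˡ (pow-+ (x - - 1#) a a) ⟨
    Q * pow (x - - 1#) (a ℕ.+ a)                   ≡⟨ ≡.cong (λ e → Q * pow (x - - 1#) e) (twice-minus-four a) ⟨
    Q * pow (x - - 1#) (2 *ℕ n ∸ 4)                ∎
    where
    n = suc (suc a)
    P = pow (x - - 1#) a
    Q = ((x - (nat n - 1#)) * (x - (nat n - 1#)) - (nat n * nat n - nat 3 * nat n + nat 3))
        * ((x - - 1#) * (x - - 1#) - (nat n - 1#))
    2+_ : Polynomial 3 → Polynomial 3
    2+ m = con (+ 1) :+ (con (+ 1) :+ m)
    three : Polynomial 3
    three = con (+ 1) :+ (con (+ 1) :+ (con (+ 1) :+ con (+ 0)))

  prod-conjugate-roots : ∀ x u s t →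
    prod ((x - (u - 1# + s)) ∷ (x - (- 1# + t)) ∷ (x - (- 1# - t)) ∷ (x - (u - 1# - s)) ∷ [])
      ≈ ((x - (u - 1#)) * (x - (u - 1#)) - s * s) * ((x - - 1#) * (x - - 1#) - t * t)
  prod-conjugate-roots = solve 4 (λ x u s t →
    (x :- (u :- con (+ 1) :+ s))
      :* ((x :- (:- con (+ 1) :+ t)) :* ((x :- (:- con (+ 1) :- t)) :* ((x :- (u :- con (+ 1) :- s)) :* con (+ 1))))
      := ((x :- (u :- con (+ 1))) :* (x :- (u :- con (+ 1))) :- s :* s) :* ((x :- :- con (+ 1)) :* (x :- :- con (+ 1)) :- t :* t))
    refl

theorem3p6 : ∀ {c ℓ : Level} (R : CommutativeRing c ℓ) (n : ℕ) → 2 ≤ n →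
    let open CommutativeRing R
        open RingDefs R
    in (s t : Carrier) →
       s * s ≈ nat n * nat n - nat 3 * nat n + nat 3 →
       t * t ≈ nat n - 1# →
       ∀ (x : Carrier) →
       charPoly (adjacency (SbarPlus n n)) x
         ≈ prod ( (x - (nat n - 1# + s))
                ∷ (x - (- 1# + t))
                ∷ (x - (- 1# - t))
                ∷ (x - (nat n - 1# - s))
                ∷ [] )
           * pow (x - (- 1#)) (2 *ℕ n ∸ 4)
theorem3p6 R n@(suc (suc a)) (s≤s (s≤s z≤n)) s t s² t² x = begin
  charPoly (adjacency (SbarPlus n n)) x
    ≈⟨ charPoly-SbarPlus a x ⟩
  ((x - (nat n - 1#)) * (x - (nat n - 1#)) - (nat n * nat n - nat 3 * nat n + nat 3))
    * ((x - - 1#) * (x - - 1#) - (nat n - 1#)) * pow (x - - 1#) (2 *ℕ n ∸ 4)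
    ≈⟨ *-congʳ (*-cong (+-congˡ (-‿cong s²)) (+-congˡ (-‿cong t²))) ⟨
  ((x - (nat n - 1#)) * (x - (nat n - 1#)) - s * s) * ((x - - 1#) * (x - - 1#) - t * t)
    * pow (x - - 1#) (2 *ℕ n ∸ 4)
    ≈⟨ *-congʳ (prod-conjugate-roots x (nat n) s t) ⟨
  prod ((x - (nat n - 1# + s)) ∷ (x - (- 1# + t)) ∷ (x - (- 1# - t)) ∷ (x - (nat n - 1# - s)) ∷ [])
    * pow (x - (- 1#)) (2 *ℕ n ∸ 4) ∎
  where
  open CommutativeRing R
  open RingDefs R
  open CharacteristicPolynomial R using (charPoly-SbarPlus; prod-conjugate-roots)
  open import Relation.Binary.Reasoning.Setoid setoid
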